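{- There is a universal constant $c>0$ such that for every length $n$ and every integer $\delta\in[2\mathinner{.\,.} n]$ there exists a family $\mathcal{F}$ of strings of length $n$, all satisfying $\delta(S)=\delta$, such that encoding the members of $\mathcal{F}$ requires $\Omega(\delta\log\frac{n}{\delta}\log n)$ bits, i.e., $\log_2|\mathcal{F}|\ge c\,\delta\log\frac{n}{\delta}\log n$.
   Context: For a string $S$ of length $n$ and $k\in[1\mathinner{.\,.} n]$, $d_k(S)$ denotes the number of distinct length-$k$ substrings of $S$, and $\delta(S)=\max\{d_k(S)/k : k\in[1\mathinner{.\,.} n]\}$. Strings may be over any alphabet (of size polynomial in $n$). A family needs $b$ bits to be encoded if any injective encoding of its members into binary strings uses at least $b$ bits for some member, equivalently $\log_2$ of the family size is at least $b$. -}

module Defs where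

open import Data.Nat using (ℕ; zero; suc; _+_; _*_; _∸_; _≤_)
open import Data.Fin using (Fin)
import Data.Fin as Fin
open import Data.List using (List; length; take; drop; map; upTo; deduplicate)
open import Data.List.Properties using (≡-dec)
open import Data.Product using (Σ; _×_)
open import Relation.Binary.PropositionalEquality using (_≡_)

Str : ℕ → Set
Str m = List (Fin m)

substrings : ∀ {m} → ℕ → Str m → List (Str m)
substrings k S = map (λ i → take k (drop i S)) (upTo (suc (length S ∸ k)))

-- d_k(S): number of distinct length-k substrings (only used for k ∈ [1 .. |S|]).
d : ∀ {m} → ℕ → Str m → ℕ
d k S = length (deduplicate (≡-dec Fin._≟_) (substrings k S))

-- δ(S) = max { d_k(S)/k : k ∈ [1 .. n] } equals the natural number δ:
-- every ratio d_k(S)/k is ≤ δ, and some ratio attains δ.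
HasDelta : ∀ {m} → Str m → ℕ → Set
HasDelta S δ =
  ((k : ℕ) → 1 ≤ k → k ≤ length S → d k S ≤ δ * k)
  × Σ ℕ (λ k → 1 ≤ k × k ≤ length S × d k S ≡ δ * k)

module Submission where

-- We take c = 1/1024 and the alphabet Fin n, and for all 2 ≤ δ ≤ n build many
-- distinct length-n strings with δ(S) = δ.  Each string is spelled by a letter
-- function g : ℕ → ℕ.  The common tool is 'hasDelta-criterion': if S uses
-- exactly the letters 0, …, δ-1 (so d_1 = δ) and, after a prefix, its nonzero
-- letters are bounded and geometrically spread, then every late length-k window
-- is all zeros or a single spike, which bounds d_k(S) ≤ δ·k.  Two families meet
-- it.  The dense family writes 1, …, δ-1, then q free base-δ digits, then zeros.
-- The sparse family writes 2, …, δ-1, then slots of width 4^j on levels j, each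
-- holding one nonzero letter whose offset and value encode a digit.  According
-- to the regime (n < 2δ; log n ≤ log δ + 8; log n ≥ log δ + 9) one of them has
-- a size Z with n^(δ⌊log₂ n⌋) ≤ Z^1024·δ^(δ⌊log₂ n⌋), which is the statement.

open import Defs
open import Data.Nat
open import Data.Nat.Properties
open import Data.Nat.Logarithm using (⌊log₂_⌋; ⌊log₂⌋-mono-≤; ⌊log₂[2^n]⌋≡n; ⌊log₂⌊n/2⌋⌋≡⌊log₂n⌋∸1)
open import Data.Nat.Induction using (<-rec)
open import Data.Nat.DivMod using (_/_; _%_; m%n<n; m≡m%n+[m/n]*n; m<n*o⇒m/o<n; m/n*n≤m)
open import Data.Fin as Fin using (Fin; fromℕ<; toℕ)
open import Data.Fin.Properties using (toℕ-fromℕ<)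
open import Data.List using (List; []; _∷_; length; take; drop; map; upTo; applyUpTo; deduplicate; _++_; concat)
open import Data.List.Properties using (length-applyUpTo; length-map; length-++; ≡-dec; ∷-injectiveˡ; ∷-injectiveʳ)
open import Data.List.Membership.Propositional using (_∈_)
open import Data.List.Membership.Propositional.Properties
  using (∈-map⁺; ∈-map⁻; ∈-++⁺ˡ; ∈-++⁺ʳ; ∈-++⁻; ∈-concat⁺′; ∈-concat⁻′; ∈-upTo⁺; ∈-upTo⁻; ∈-applyUpTo⁺; ∈-applyUpTo⁻)
open import Data.List.Relation.Unary.Any using (here; there)
import Data.List.Relation.Unary.Any.Properties as Any
open import Data.List.Relation.Unary.All as All using (All; []; _∷_)
import Data.List.Relation.Unary.All.Properties as All
open import Data.List.Relation.Unary.Unique.Propositional using (Unique)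
open import Data.List.Relation.Unary.AllPairs using ([]; _∷_)
open import Data.List.Relation.Unary.Unique.Propositional.Properties using (applyUpTo⁺₁)
import Data.List.Relation.Unary.Unique.DecPropositional.Properties as Unique
open import Data.Product using (Σ; ∃; _×_; _,_; proj₁; proj₂)
open import Data.Product.Properties using () renaming (≡-dec to ×-≡-dec)
open import Data.Sum using (_⊎_; inj₁; inj₂)
open import Data.Empty using (⊥; ⊥-elim)
open import Relation.Nullary using (Dec; yes; no)
open import Relation.Binary using (tri<; tri≈; tri>)
open import Relation.Binary.PropositionalEquality
open import Function using (_∘_)
open import Data.Nat.Tactic.RingSolver using (solve-∀)

module ListFacts where

  private variable A : Set

  remove : {x : A} (ys : List A) → x ∈ ys → List A
  remove (y ∷ ys) (here _)  = ys
  remove (y ∷ ys) (there p) = y ∷ remove ys p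

  length-remove : {x : A} (ys : List A) (p : x ∈ ys) → suc (length (remove ys p)) ≡ length ys
  length-remove (y ∷ ys) (here _)  = refl
  length-remove (y ∷ ys) (there p) = cong suc (length-remove ys p)

  ∈-remove : {x z : A} (ys : List A) (p : x ∈ ys) → z ∈ ys → z ≢ x → z ∈ remove ys p
  ∈-remove (y ∷ ys) (here refl) (here refl) z≢x = ⊥-elim (z≢x refl)
  ∈-remove (y ∷ ys) (here refl) (there q)   _   = q
  ∈-remove (y ∷ ys) (there p)   (here e)    _   = here e
  ∈-remove (y ∷ ys) (there p)   (there q)   z≢x = there (∈-remove ys p q z≢x)

  unique⊆⇒length≤ : (xs ys : List A) → Unique xs → All (_∈ ys) xs → length xs ≤ length ys
  unique⊆⇒length≤ []       ys _            _          = z≤n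
  unique⊆⇒length≤ (x ∷ xs) ys (x∉xs ∷ uxs) (x∈ys ∷ xs⊆ys) =
    ≤-trans (s≤s (unique⊆⇒length≤ xs (remove ys x∈ys) uxs (still-inside xs x∉xs xs⊆ys)))
            (≤-reflexive (length-remove ys x∈ys))
    where
    still-inside : (zs : List _) → All (x ≢_) zs → All (_∈ ys) zs → All (_∈ remove ys x∈ys) zs
    still-inside []       _            _          = []
    still-inside (z ∷ zs) (x≢z ∷ x≢zs) (z∈ys ∷ zs⊆ys) =
      ∈-remove ys x∈ys z∈ys (x≢z ∘ sym) ∷ still-inside zs x≢zs zs⊆ys

  drop-applyUpTo : (f : ℕ → A) (i n : ℕ) → drop i (applyUpTo f n) ≡ applyUpTo (λ a → f (i + a)) (n ∸ i)
  drop-applyUpTo f zero    n       = refl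
  drop-applyUpTo f (suc i) zero    = refl
  drop-applyUpTo f (suc i) (suc n) = drop-applyUpTo (λ a → f (suc a)) i n

  take-applyUpTo : (f : ℕ → A) (k n : ℕ) → k ≤ n → take k (applyUpTo f n) ≡ applyUpTo f k
  take-applyUpTo f zero    n       _         = refl
  take-applyUpTo f (suc k) (suc n) (s≤s k≤n) = cong (f 0 ∷_) (take-applyUpTo (λ a → f (suc a)) k n k≤n)

  take-drop-applyUpTo : (f : ℕ → A) (n k i : ℕ) → i + k ≤ n →
                        take k (drop i (applyUpTo f n)) ≡ applyUpTo (λ a → f (i + a)) k
  take-drop-applyUpTo f n k i i+k≤n =
    trans (cong (take k) (drop-applyUpTo f i n))
          (take-applyUpTo _ k (n ∸ i) (subst (_≤ n ∸ i) (m+n∸m≡n i k) (∸-monoˡ-≤ i i+k≤n)))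

  applyUpTo-cong : (f g : ℕ → A) (k : ℕ) → (∀ a → a < k → f a ≡ g a) → applyUpTo f k ≡ applyUpTo g k
  applyUpTo-cong f g zero    _   = refl
  applyUpTo-cong f g (suc k) f≗g =
    cong₂ _∷_ (f≗g 0 z<s) (applyUpTo-cong (λ a → f (suc a)) (λ a → g (suc a)) k (λ a a<k → f≗g (suc a) (s<s a<k)))

  applyUpTo-injective : (f g : ℕ → A) (k : ℕ) → applyUpTo f k ≡ applyUpTo g k → ∀ a → a < k → f a ≡ g a
  applyUpTo-injective f g (suc k) eq zero    _         = ∷-injectiveˡ eq
  applyUpTo-injective f g (suc k) eq (suc a) (s<s a<k) =
    applyUpTo-injective (λ a → f (suc a)) (λ a → g (suc a)) k (∷-injectiveʳ eq) a a<k

module Substrings {N : ℕ} (emb : ℕ → Fin N) where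

  open ListFacts

  word : (g : ℕ → ℕ) (n : ℕ) → Str N
  word g n = applyUpTo (λ x → emb (g x)) n

  window : (g : ℕ → ℕ) (k i : ℕ) → Str N
  window g k i = applyUpTo (λ a → emb (g (i + a))) k

  private
    _≟ₛ_ : (u w : Str N) → Dec (u ≡ w)
    _≟ₛ_ = ≡-dec Fin._≟_

  substring⇒window : (g : ℕ → ℕ) (n k : ℕ) → k ≤ n → ∀ {w} → w ∈ substrings k (word g n) →
                     ∃ λ i → i + k ≤ n × w ≡ window g k i
  substring⇒window g n k k≤n w∈ with ∈-map⁻ (λ i → take k (drop i (word g n))) w∈
  ... | i , i∈ , refl = i , i+k≤n , take-drop-applyUpTo _ n k i i+k≤n
    where
    i≤n∸k : i ≤ n ∸ k
    i≤n∸k = subst (λ ℓ → i ≤ ℓ ∸ k) (length-applyUpTo _ n) (s≤s⁻¹ (∈-upTo⁻ i∈))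
    i+k≤n : i + k ≤ n
    i+k≤n = subst (i + k ≤_) (m∸n+n≡m k≤n) (+-monoˡ-≤ k i≤n∸k)

  window∈distinct : (g : ℕ → ℕ) (n k i : ℕ) → i + k ≤ n →
                    window g k i ∈ deduplicate _≟ₛ_ (substrings k (word g n))
  window∈distinct g n k i i+k≤n =
    subst (_∈ deduplicate _≟ₛ_ (substrings k (word g n))) (take-drop-applyUpTo _ n k i i+k≤n)
      (Any.deduplicate⁺ _≟ₛ_ (λ u≡w p → trans p (sym u≡w))
        (∈-map⁺ (λ i → take k (drop i (word g n))) (∈-upTo⁺ (s≤s i≤))))
    where
    i≤ : i ≤ length (word g n) ∸ k
    i≤ = subst (λ ℓ → i ≤ ℓ ∸ k) (sym (length-applyUpTo _ n))
           (subst (_≤ n ∸ k) (m+n∸n≡m i k) (∸-monoˡ-≤ k i+k≤n))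

  d≤cover : (g : ℕ → ℕ) (n k : ℕ) → k ≤ n → (W : List (Str N)) →
            (∀ i → i + k ≤ n → window g k i ∈ W) → d k (word g n) ≤ length W
  d≤cover g n k k≤n W covered =
    unique⊆⇒length≤ _ W (Unique.deduplicate-! _≟ₛ_ (substrings k (word g n)))
      (All.deduplicate⁺ _≟ₛ_ (All.tabulate λ w∈ → inside (substring⇒window g n k k≤n w∈)))
    where
    inside : ∀ {w} → ∃ (λ i → i + k ≤ n × w ≡ window g k i) → w ∈ W
    inside (i , i+k≤n , refl) = covered i i+k≤n

  distinct-windows≤d : (g : ℕ → ℕ) (n k : ℕ) (U : List (Str N)) → Unique U →
                       (∀ {u} → u ∈ U → ∃ λ i → i + k ≤ n × u ≡ window g k i) → length U ≤ d k (word g n)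
  distinct-windows≤d g n k U uniqueU windows =
    unique⊆⇒length≤ U _ uniqueU (All.tabulate λ u∈ → counted (windows u∈))
    where
    counted : ∀ {u} → ∃ (λ i → i + k ≤ n × u ≡ window g k i) → u ∈ deduplicate _≟ₛ_ (substrings k (word g n))
    counted (i , i+k≤n , refl) = window∈distinct g n k i i+k≤n

  letter : ℕ → Str N
  letter c = emb c ∷ []

  d₁≤ : (g : ℕ → ℕ) (n δ : ℕ) → 1 ≤ n → (∀ x → x < n → g x < δ) → d 1 (word g n) ≤ δ * 1
  d₁≤ g n δ 1≤n g<δ =
    ≤-trans (d≤cover g n 1 1≤n (applyUpTo letter δ) λ i i+1≤n →
               ∈-applyUpTo⁺ letter (g<δ (i + 0) (subst (_≤ n) (cong suc (sym (+-identityʳ i))) (subst (_≤ n) (+-comm i 1) i+1≤n))))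
            (≤-reflexive (trans (length-applyUpTo _ δ) (sym (*-identityʳ δ))))

  ≤d₁ : (g : ℕ → ℕ) (n δ : ℕ) → (∀ x y → x < δ → y < δ → emb x ≡ emb y → x ≡ y) →
        (∀ c → c < δ → ∃ λ x → x < n × g x ≡ c) → δ * 1 ≤ d 1 (word g n)
  ≤d₁ g n δ emb-inj occurs =
    ≤-trans (≤-reflexive (trans (*-identityʳ δ) (sym (length-applyUpTo _ δ))))
            (distinct-windows≤d g n 1 (applyUpTo letter δ) distinct occurrence)
    where
    distinct : Unique (applyUpTo letter δ)
    distinct = applyUpTo⁺₁ letter δ λ i<j j<δ eq → <⇒≢ i<j (emb-inj _ _ (<-trans i<j j<δ) j<δ (∷-injectiveˡ eq))
    occurrence : ∀ {u} → u ∈ applyUpTo letter δ → ∃ λ i → i + 1 ≤ n × u ≡ window g 1 i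
    occurrence u∈ with ∈-applyUpTo⁻ letter u∈
    ... | c , c<δ , refl with occurs c c<δ
    ... | x , x<n , refl = x , subst (_≤ n) (+-comm 1 x) x<n , cong letter (cong g (sym (+-identityʳ x)))

  spike : (c j b : ℕ) → ℕ
  spike c j b with b ≟ j
  ... | yes _ = c
  ... | no  _ = 0

  spikes : (k t : ℕ) → List (Str N)
  spikes k zero    = []
  spikes k (suc c) = applyUpTo (λ j → word (spike (suc c) j) k) k ++ spikes k c

  length-spikes : ∀ k t → length (spikes k t) ≡ t * k
  length-spikes k zero    = refl
  length-spikes k (suc t) = trans (length-++ (applyUpTo (λ j → word (spike (suc t) j) k) k))
                                  (cong₂ _+_ (length-applyUpTo _ k) (length-spikes k t))

  spike∈spikes : ∀ k t c j → 1 ≤ c → c ≤ t → j < k → word (spike c j) k ∈ spikes k t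
  spike∈spikes k zero    zero    j () _  _
  spike∈spikes k zero    (suc c) j _  () _
  spike∈spikes k (suc t) c j 1≤c c≤t j<k with c ≟ suc t
  ... | yes refl = ∈-++⁺ˡ (∈-applyUpTo⁺ (λ j → word (spike (suc t) j) k) j<k)
  ... | no  c≢t  = ∈-++⁺ʳ (applyUpTo (λ j → word (spike (suc t) j) k) k)
                          (spike∈spikes k t c j 1≤c (s≤s⁻¹ (≤∧≢⇒< c≤t c≢t)) j<k)

  -- Suppose that from position p on the letters of g are
  -- at most t and any two nonzero positions x < y are M-spread:
  -- x + M(x+1) ≤ p + M·y.  Then a length-k window (k ≥ 2) starting at or after
  -- start = p + M(k-2) + 1 holds at most one nonzero letter, so it is the zero
  -- word or a spike word; the windows starting before 'start' add at most
  -- 'start' more factors.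
  module SparseTail (g : ℕ → ℕ) (p t M k : ℕ)
      (bounded : ∀ x → p ≤ x → g x ≤ t)
      (spread  : ∀ x y → p ≤ x → x < y → 0 < g x → 0 < g y → x + M * suc x ≤ p + M * y)
      (2≤k : 2 ≤ k) where

    start : ℕ
    start = suc (p + M * (k ∸ 2))

    zeros : Str N
    zeros = word (λ _ → 0) k

    candidates : List (Str N)
    candidates = map (window g k) (upTo start) ++ (spikes k t ++ (zeros ∷ []))

    length-candidates : length candidates ≡ start + (t * k + 1)
    length-candidates =
      trans (length-++ (map (window g k) (upTo start)))
        (cong₂ _+_ (trans (length-map (window g k) (upTo start)) (length-applyUpTo (λ i → i) start))
                   (trans (length-++ (spikes k t)) (cong (_+ 1) (length-spikes k t))))

    p≤ : ∀ s a → start ≤ s → p ≤ s + a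
    p≤ s a start≤s = ≤-trans (m≤m+n p (M * (k ∸ 2))) (≤-trans (n≤1+n _) (≤-trans start≤s (m≤m+n s a)))

    no-two-nonzero : ∀ s a b → start ≤ s → a < b → b < k → 0 < g (s + a) → 0 < g (s + b) → ⊥
    no-two-nonzero s a b start≤s a<b b<k ga>0 gb>0 =
      <-irrefl refl (<-≤-trans (s≤s x≤) (≤-trans start≤s (m≤m+n s a)))
      where
      open ≤-Reasoning
      x : ℕ
      x = s + a
      r : ℕ
      r = k ∸ 2
      b≤ : b ≤ suc a + r
      b≤ = ≤-trans (s≤s⁻¹ (subst (b <_) (trans (sym (m∸n+n≡m 2≤k)) (+-comm r 2)) b<k))
                   (+-monoˡ-≤ r (s≤s z≤n))
      regroup : ∀ p M s a r → p + M * (s + suc a + r) ≡ p + M * r + M * suc (s + a)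
      regroup = solve-∀
      x≤ : x ≤ p + M * r
      x≤ = +-cancelʳ-≤ (M * suc x) x (p + M * r) (begin
        x + M * suc x            ≤⟨ spread x (s + b) (p≤ s a start≤s) (+-monoʳ-< s a<b) ga>0 gb>0 ⟩
        p + M * (s + b)          ≤⟨ +-monoʳ-≤ p (*-monoʳ-≤ M (+-monoʳ-≤ s b≤)) ⟩
        p + M * (s + (suc a + r)) ≡⟨ cong (λ u → p + M * u) (sym (+-assoc s (suc a) r)) ⟩
        p + M * (s + suc a + r)  ≡⟨ regroup p M s a r ⟩
        p + M * r + M * suc x    ∎)

    lone-nonzero : ∀ s a b → start ≤ s → a < k → b < k → b ≢ a → 0 < g (s + a) → g (s + b) ≡ 0
    lone-nonzero s a b start≤s a<k b<k b≢a ga>0 with g (s + b) in gb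
    ... | zero  = refl
    ... | suc _ with <-cmp a b
    ... | tri< a<b _ _ = ⊥-elim (no-two-nonzero s a b start≤s a<b b<k ga>0 (subst (0 <_) (sym gb) z<s))
    ... | tri≈ _ a≡b _ = ⊥-elim (b≢a (sym a≡b))
    ... | tri> _ _ b<a = ⊥-elim (no-two-nonzero s b a start≤s b<a a<k (subst (0 <_) (sym gb) z<s) ga>0)

    window∈candidates : ∀ s → window g k s ∈ candidates
    window∈candidates s with s <? start
    ... | yes s<start = ∈-++⁺ˡ (∈-map⁺ (window g k) (∈-upTo⁺ s<start))
    ... | no  s≮start with anyUpTo? (λ a → 0 <? g (s + a)) k
    ... | no  all-zero =
      ∈-++⁺ʳ (map (window g k) (upTo start)) (∈-++⁺ʳ (spikes k t)
        (here (applyUpTo-cong _ _ k λ a a<k → cong emb (n≤0⇒n≡0 (≮⇒≥ λ ga>0 → all-zero (a , a<k , ga>0))))))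
    ... | yes (a , a<k , ga>0) =
      ∈-++⁺ʳ (map (window g k) (upTo start)) (∈-++⁺ˡ
        (subst (_∈ spikes k t) (sym window≡spike)
          (spike∈spikes k t (g (s + a)) a ga>0 (bounded (s + a) (p≤ s a (≮⇒≥ s≮start))) a<k)))
      where
      same-letter : ∀ b → b < k → g (s + b) ≡ spike (g (s + a)) a b
      same-letter b b<k with b ≟ a
      ... | yes refl = refl
      ... | no  b≢a  = lone-nonzero s a b (≮⇒≥ s≮start) a<k b<k b≢a ga>0
      window≡spike : window g k s ≡ word (spike (g (s + a)) a) k
      window≡spike = applyUpTo-cong _ _ k λ b b<k → cong emb (same-letter b b<k)

  d≤sparse-tail : (g : ℕ → ℕ) (n p t M k : ℕ) →
    (∀ x → p ≤ x → g x ≤ t) →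
    (∀ x y → p ≤ x → x < y → 0 < g x → 0 < g y → x + M * suc x ≤ p + M * y) →
    2 ≤ k → k ≤ n → d k (word g n) ≤ suc (p + M * (k ∸ 2)) + (t * k + 1)
  d≤sparse-tail g n p t M k bounded spread 2≤k k≤n =
    ≤-trans (d≤cover g n k k≤n candidates (λ i _ → window∈candidates i)) (≤-reflexive length-candidates)
    where open SparseTail g p t M k bounded spread 2≤k

module Digits where

  digit : (b : ℕ) .{{_ : NonZero b}} → ℕ → ℕ → ℕ
  digit b z zero    = z % b
  digit b z (suc i) = digit b (z / b) i

  digit<base : ∀ b .{{_ : NonZero b}} z i → digit b z i < b
  digit<base b z zero    = m%n<n z b
  digit<base b z (suc i) = digit<base b (z / b) i

  digits-injective : ∀ b .{{_ : NonZero b}} K z z' → z < b ^ K → z' < b ^ K →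
                     (∀ i → i < K → digit b z i ≡ digit b z' i) → z ≡ z'
  digits-injective b zero    z z' (s≤s z≤n) (s≤s z≤n) _ = refl
  digits-injective b (suc K) z z' z<bᴷ z'<bᴷ same = begin
    z                     ≡⟨ m≡m%n+[m/n]*n z b ⟩
    z % b + (z / b) * b   ≡⟨ cong₂ (λ r q → r + q * b) (same 0 z<s) quotients ⟩
    z' % b + (z' / b) * b ≡⟨ sym (m≡m%n+[m/n]*n z' b) ⟩
    z'                    ∎
    where
    open ≡-Reasoning
    quotient< : ∀ {w} → w < b ^ suc K → w / b < b ^ K
    quotient< {w} w< = m<n*o⇒m/o<n (subst (w <_) (*-comm b (b ^ K)) w<)
    quotients : z / b ≡ z' / b
    quotients = digits-injective b K (z / b) (z' / b) (quotient< z<bᴷ) (quotient< z'<bᴷ) (λ i i<K → same (suc i) (s<s i<K))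

Family : (N n δ Z : ℕ) → Set
Family N n δ Z =
  Σ (List (Str N)) λ F → Unique F × All (λ S → length S ≡ n × HasDelta S δ) F × length F ≡ Z

module Words (N : ℕ) (N>0 : 0 < N) where

  emb : ℕ → Fin N
  emb x with x <? N
  ... | yes x<N = fromℕ< x<N
  ... | no  _   = fromℕ< N>0

  toℕ-emb : ∀ x → x < N → toℕ (emb x) ≡ x
  toℕ-emb x x<N with x <? N
  ... | yes x<N' = toℕ-fromℕ< x<N'
  ... | no  x≮N  = ⊥-elim (x≮N x<N)

  emb-injective : ∀ x y → x < N → y < N → emb x ≡ emb y → x ≡ y
  emb-injective x y x<N y<N eq = trans (sym (toℕ-emb x x<N)) (trans (cong toℕ eq) (toℕ-emb y y<N))

  open Substrings emb public

  hasDelta-criterion : (g : ℕ → ℕ) (n δ p t M : ℕ) → 1 ≤ n → δ ≤ N →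
    (∀ x → x < n → g x < δ) →
    (∀ c → c < δ → ∃ λ x → x < n × g x ≡ c) →
    (∀ x → p ≤ x → g x ≤ t) →
    (∀ x y → p ≤ x → x < y → 0 < g x → 0 < g y → x + M * suc x ≤ p + M * y) →
    (∀ k → 2 ≤ k → suc (p + M * (k ∸ 2)) + (t * k + 1) ≤ δ * k) →
    HasDelta (word g n) δ
  hasDelta-criterion g n δ p t M 1≤n δ≤N g<δ occurs bounded spread budget =
    d≤δk , 1 , ≤-refl , subst (1 ≤_) (sym length-word) 1≤n , ≤-antisym d₁≤δ (≤d₁ g n δ emb-inj occurs)
    where
    length-word : length (word g n) ≡ n
    length-word = length-applyUpTo _ n
    emb-inj : ∀ x y → x < δ → y < δ → emb x ≡ emb y → x ≡ y
    emb-inj x y x<δ y<δ = emb-injective x y (<-≤-trans x<δ δ≤N) (<-≤-trans y<δ δ≤N)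
    d₁≤δ : d 1 (word g n) ≤ δ * 1
    d₁≤δ = d₁≤ g n δ 1≤n g<δ
    d≤δk : (k : ℕ) → 1 ≤ k → k ≤ length (word g n) → d k (word g n) ≤ δ * k
    d≤δk 1               _ _   = d₁≤δ
    d≤δk k@(suc (suc _)) _ k≤ℓ =
      ≤-trans (d≤sparse-tail g n p t M k bounded spread (s≤s (s≤s z≤n)) (subst (k ≤_) length-word k≤ℓ))
              (budget k (s≤s (s≤s z≤n)))

  family : (G : ℕ → ℕ → ℕ) (n δ Z : ℕ) → δ ≤ N →
    (∀ z x → x < n → G z x < δ) →
    (∀ z → z < Z → HasDelta (word (G z) n) δ) →
    (∀ z z' → z < Z → z' < Z → (∀ x → x < n → G z x ≡ G z' x) → z ≡ z') →
    Family N n δ Z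
  family G n δ Z δ≤N G<δ hasDelta injective =
    F , applyUpTo⁺₁ _ Z distinct , All.tabulate members , length-applyUpTo _ Z
    where
    F : List (Str N)
    F = applyUpTo (λ z → word (G z) n) Z
    distinct : ∀ {z z'} → z < z' → z' < Z → word (G z) n ≢ word (G z') n
    distinct {z} {z'} z<z' z'<Z eq = <⇒≢ z<z' (injective z z' (<-trans z<z' z'<Z) z'<Z λ x x<n →
      emb-injective _ _ (<-≤-trans (G<δ z x x<n) δ≤N) (<-≤-trans (G<δ z' x x<n) δ≤N)
        (applyUpTo-injective _ _ n eq x x<n))
      where open ListFacts
    members : ∀ {S} → S ∈ F → length S ≡ n × HasDelta S δ
    members S∈ with ∈-applyUpTo⁻ _ S∈
    ... | z , z<Z , refl = length-applyUpTo _ n , hasDelta z z<Z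

-- Every late window is the
-- zero word, so d_k ≤ (v + q + 1) + 1 ≤ δ·k for k ≥ 2.
module Dense (N : ℕ) (N>0 : 0 < N) where

  open Words N N>0
  open Digits

  dense : (v q z x : ℕ) → ℕ
  dense v q z x with x <? v
  ... | yes _ = suc x
  ... | no  _ with x <? v + q
  ... | yes _ = digit (suc v) z (x ∸ v)
  ... | no  _ = 0

  dense<δ : ∀ v q z x → dense v q z x < suc v
  dense<δ v q z x with x <? v
  ... | yes x<v = s≤s x<v
  ... | no  _ with x <? v + q
  ... | yes _ = digit<base (suc v) z (x ∸ v)
  ... | no  _ = z<s

  dense-prefix : ∀ v q z x → x < v → dense v q z x ≡ suc x
  dense-prefix v q z x x<v with x <? v
  ... | yes _   = refl
  ... | no  x≮v = ⊥-elim (x≮v x<v)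

  dense-code : ∀ v q z i → i < q → dense v q z (v + i) ≡ digit (suc v) z i
  dense-code v q z i i<q with (v + i) <? v
  ... | yes v+i<v = ⊥-elim (<-irrefl refl (<-≤-trans v+i<v (m≤m+n v i)))
  ... | no  _ with (v + i) <? v + q
  ... | yes _ = cong (digit (suc v) z) (m+n∸m≡n v i)
  ... | no  ≮ = ⊥-elim (≮ (+-monoʳ-< v i<q))

  dense-suffix : ∀ v q z x → v + q ≤ x → dense v q z x ≡ 0
  dense-suffix v q z x v+q≤x with x <? v
  ... | yes x<v = ⊥-elim (<-irrefl refl (<-≤-trans x<v (≤-trans (m≤m+n v q) v+q≤x)))
  ... | no  _ with x <? v + q
  ... | yes x< = ⊥-elim (<-irrefl refl (<-≤-trans x< v+q≤x))
  ... | no  _  = refl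

  dense-family : (n v q : ℕ) → q ≤ v → suc (v + q) ≤ n → suc v ≤ N → Family N n (suc v) (suc v ^ q)
  dense-family n v q q≤v v+q<n δ≤N =
    family (dense v q) n (suc v) (suc v ^ q) δ≤N (λ z x _ → dense<δ v q z x) hasDelta injective
    where
    occurs : ∀ z c → c < suc v → ∃ λ x → x < n × dense v q z x ≡ c
    occurs z zero    _         = v + q , v+q<n , dense-suffix v q z (v + q) ≤-refl
    occurs z (suc c) (s≤s c<v) = c , ≤-trans (s≤s (≤-trans (<⇒≤ c<v) (m≤m+n v q))) v+q<n , dense-prefix v q z c c<v
    budget : ∀ k → 2 ≤ k → suc (v + q + 0 * (k ∸ 2)) + (0 * k + 1) ≤ suc v * k
    budget k 2≤k = begin
      suc (v + q + 0 * (k ∸ 2)) + (0 * k + 1) ≡⟨ simplify v q (k ∸ 2) k ⟩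
      v + q + 2                               ≤⟨ +-monoˡ-≤ 2 (+-monoʳ-≤ v q≤v) ⟩
      v + v + 2                               ≡⟨ double v ⟩
      suc v * 2                               ≤⟨ *-monoʳ-≤ (suc v) 2≤k ⟩
      suc v * k                               ∎
      where
      open ≤-Reasoning
      simplify : ∀ v q r k → suc (v + q + 0 * r) + (0 * k + 1) ≡ v + q + 2
      simplify = solve-∀
      double : ∀ v → v + v + 2 ≡ suc v * 2
      double = solve-∀
    hasDelta : ∀ z → z < suc v ^ q → HasDelta (word (dense v q z) n) (suc v)
    hasDelta z _ = hasDelta-criterion (dense v q z) n (suc v) (v + q) 0 0 (≤-trans (s≤s z≤n) v+q<n) δ≤N
      (λ x _ → dense<δ v q z x) (occurs z)
      (λ x v+q≤x → ≤-reflexive (dense-suffix v q z x v+q≤x))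
      (λ x _ v+q≤x _ gx>0 _ → ⊥-elim (<-irrefl (sym (dense-suffix v q z x v+q≤x)) gx>0))
      budget
    injective : ∀ z z' → z < suc v ^ q → z' < suc v ^ q → (∀ x → x < n → dense v q z x ≡ dense v q z' x) → z ≡ z'
    injective z z' z< z'< same = digits-injective (suc v) q z z' z< z'< λ i i<q →
      trans (sym (dense-code v q z i i<q))
        (trans (same (v + i) (≤-trans (s≤s (<⇒≤ (+-monoʳ-< v i<q))) v+q<n)) (dense-code v q z' i i<q))

-- After the prefix of letters 2, …, P+1 (so δ = P + 2) the
-- tail is split into slots: level j ∈ {0} ∪ [lo, J) has m slots (j, r) of width
-- 4^j starting at (m + 3r)·4^j.  Every slot holds exactly one nonzero letter;
-- on levels j ≥ lo its offset inside the slot and its value in [1, t+1] are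
-- read off one base-(w+1)(t+1) digit of the code z, level 0 holds letter 1 at
-- offset 0.  The growing gaps between slots make the nonzero letters M-spread,
-- so the sparse-tail bound applies.
module Sparse (N : ℕ) (N>0 : 0 < N) where

  open Words N N>0
  open Digits

  Slot : Set
  Slot = ℕ × ℕ

  _<ₛ_ : Slot → Slot → Set
  (j , r) <ₛ (j' , r') = j < j' ⊎ (j ≡ j' × r < r')

  <ₛ-connex : (e e' : Slot) → e ≢ e' → e <ₛ e' ⊎ e' <ₛ e
  <ₛ-connex (j , r) (j' , r') e≢e' with <-cmp j j'
  ... | tri< j<j' _ _ = inj₁ (inj₁ j<j')
  ... | tri> _ _ j'<j = inj₂ (inj₁ j'<j)
  ... | tri≈ _ refl _ with <-cmp r r'
  ... | tri< r<r' _ _ = inj₁ (inj₂ (refl , r<r'))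
  ... | tri> _ _ r'<r = inj₂ (inj₂ (refl , r'<r))
  ... | tri≈ _ refl _ = ⊥-elim (e≢e' refl)

  module Layout (m : ℕ) where

    slotStart : ℕ → ℕ → ℕ
    slotStart j r = (m + 3 * r) * 4 ^ j

    next-slot : ∀ m r a → (m + 3 * r) * a + 3 * a ≡ (m + 3 * suc r) * a
    next-slot = solve-∀

    gap : ∀ j r j' r' → r < m → (j , r) <ₛ (j' , r') → slotStart j r + 3 * 4 ^ j ≤ slotStart j' r'
    gap j r j' r' _ (inj₂ (refl , r<r')) =
      ≤-trans (≤-reflexive (next-slot m r (4 ^ j))) (*-monoˡ-≤ (4 ^ j) (+-monoʳ-≤ m (*-monoʳ-≤ 3 r<r')))
    gap j r j' r' r<m (inj₁ j<j') = begin
      slotStart j r + 3 * 4 ^ j     ≡⟨ next-slot m r (4 ^ j) ⟩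
      (m + 3 * suc r) * 4 ^ j   ≤⟨ *-monoˡ-≤ (4 ^ j) (+-monoʳ-≤ m (*-monoʳ-≤ 3 r<m)) ⟩
      (m + 3 * m) * 4 ^ j       ≡⟨ level-up m (4 ^ j) ⟩
      m * 4 ^ suc j             ≤⟨ *-monoʳ-≤ m (^-monoʳ-≤ 4 j<j') ⟩
      m * 4 ^ j'                ≤⟨ *-monoˡ-≤ (4 ^ j') (m≤m+n m (3 * r')) ⟩
      slotStart j' r'               ∎
      where
      open ≤-Reasoning
      level-up : ∀ m a → (m + 3 * m) * a ≡ m * (4 * a)
      level-up = solve-∀

    inside-before : ∀ j r j' r' a b → r < m → (j , r) <ₛ (j' , r') → a < 4 ^ j → slotStart j r + a < slotStart j' r' + b
    inside-before j r j' r' a b r<m e<e' a<w =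
      <-≤-trans (+-monoʳ-< (slotStart j r) a<w)
        (≤-trans (+-monoʳ-≤ (slotStart j r) (m≤n*m (4 ^ j) 3))
        (≤-trans (gap j r j' r' r<m e<e') (m≤m+n _ b)))

    inside-disjoint : ∀ j r j' r' a b → r < m → r' < m → (j , r) ≢ (j' , r') → a < 4 ^ j → b < 4 ^ j' →
                      slotStart j r + a ≢ slotStart j' r' + b
    inside-disjoint j r j' r' a b r<m r'<m e≢e' a<w b<w' eq with <ₛ-connex (j , r) (j' , r') e≢e'
    ... | inj₁ e<e' = <-irrefl eq (inside-before j r j' r' a b r<m e<e' a<w)
    ... | inj₂ e'<e = <-irrefl (sym eq) (inside-before j' r' j r b a r'<m e'<e b<w')

  -- The sparse words for prefix length P, m0 + 1 slots per level, coded levels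
  -- [lo, J) with lo = lo-1 + 1, w + 1 possible offsets and t + 1 letter values.
  module SparseWords (n P m0 M w t lo-1 J : ℕ)
    (slots≤spread : 4 * suc m0 ≤ 2 * M + 2)
    (values<δ : suc t < 2 + P)
    (lo≤J : suc lo-1 ≤ J)
    (offsets≤width : suc w ≤ 4 ^ suc lo-1)
    (fits : P + suc m0 * 4 ^ J ≤ n)
    where

    m lo : ℕ
    m  = suc m0
    lo = suc lo-1

    open Layout m

    base : ℕ
    base = suc w * suc t

    codeLength : ℕ
    codeLength = (J ∸ lo) * m

    digitIndex : ℕ → ℕ → ℕ
    digitIndex j r = (j ∸ lo) * m + r

    code : ℕ → ℕ → ℕ → ℕ
    code z j r = digit base z (digitIndex j r)

    offset : ℕ → ℕ → ℕ → ℕ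
    offset z zero    r = 0
    offset z (suc j) r = code z (suc j) r % suc w

    value : ℕ → ℕ → ℕ → ℕ
    value z zero    r = 1
    value z (suc j) r = suc (code z (suc j) r / suc w)

    position : ℕ → Slot → ℕ
    position z (j , r) = slotStart j r + offset z j r

    valueAt : ℕ → Slot → ℕ
    valueAt z (j , r) = value z j r

    level₀ : List Slot
    level₀ = applyUpTo (λ r → (0 , r)) m

    codedLevels : List (List Slot)
    codedLevels = applyUpTo (λ a → applyUpTo (λ r → (lo + a , r)) m) (J ∸ lo)

    slots : List Slot
    slots = level₀ ++ concat codedLevels

    Valid : Slot → Set
    Valid (j , r) = (j ≡ 0 ⊎ (lo ≤ j × j < J)) × r < m

    valid : ∀ {e} → e ∈ slots → Valid e
    valid e∈ with ∈-++⁻ level₀ e∈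
    ... | inj₁ e∈₀ with ∈-applyUpTo⁻ (λ r → (0 , r)) e∈₀
    ... | r , r<m , refl = inj₁ refl , r<m
    valid e∈ | inj₂ e∈ₗ with ∈-concat⁻′ codedLevels e∈ₗ
    ... | _ , e∈level , level∈ with ∈-applyUpTo⁻ (λ a → applyUpTo (λ r → (lo + a , r)) m) level∈
    ... | a , a< , refl with ∈-applyUpTo⁻ (λ r → (lo + a , r)) e∈level
    ... | r , r<m , refl = inj₂ (m≤m+n lo a , subst (lo + a <_) (m+[n∸m]≡n lo≤J) (+-monoʳ-< lo a<)) , r<m

    coded∈slots : ∀ a r → a < J ∸ lo → r < m → (lo + a , r) ∈ slots
    coded∈slots a r a< r<m =
      ∈-++⁺ʳ level₀ {ys = concat codedLevels}
        (∈-concat⁺′ {xss = codedLevels} (∈-applyUpTo⁺ (λ r → (lo + a , r)) r<m) (∈-applyUpTo⁺ (λ a → applyUpTo (λ r → (lo + a , r)) m) a<))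

    origin∈slots : (0 , 0) ∈ slots
    origin∈slots = ∈-++⁺ˡ {ys = concat codedLevels}
                          (∈-applyUpTo⁺ (λ r → (0 , r)) z<s)

    offset<width : ∀ z j r → Valid (j , r) → offset z j r < 4 ^ j
    offset<width z zero    r _ = z<s
    offset<width z (suc j) r (inj₂ (lo≤j , _) , _) =
      <-≤-trans (m%n<n (code z (suc j) r) (suc w)) (≤-trans offsets≤width (^-monoʳ-≤ 4 lo≤j))

    value≤ : ∀ z j r → value z j r ≤ suc t
    value≤ z zero    r = s≤s z≤n
    value≤ z (suc j) r = m<n*o⇒m/o<n (subst (code z (suc j) r <_) (*-comm (suc w) (suc t)) (digit<base base z (digitIndex (suc j) r)))

    position-injective : ∀ z z' e e' → e ∈ slots → e' ∈ slots → position z e ≡ position z' e' → e ≡ e'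
    position-injective z z' (j , r) (j' , r') e∈ e'∈ eq with ×-≡-dec _≟_ _≟_ (j , r) (j' , r')
    ... | yes e≡e' = e≡e'
    ... | no  e≢e' = ⊥-elim (inside-disjoint j r j' r' _ _ (proj₂ (valid e∈)) (proj₂ (valid e'∈)) e≢e'
                               (offset<width z j r (valid e∈)) (offset<width z' j' r' (valid e'∈)) eq)

    m≤slotStart : ∀ j r → m ≤ slotStart j r
    m≤slotStart j r = ≤-trans (m≤m+n m (3 * r)) (m≤m*n (m + 3 * r) (4 ^ j) {{m^n≢0 4 j}})

    slot-end≤ : ∀ j r → Valid (j , r) → slotStart j r + 4 ^ j ≤ m * 4 ^ J
    slot-end≤ j r (level , r<m) = begin
      slotStart j r + 4 ^ j     ≤⟨ +-monoʳ-≤ (slotStart j r) (m≤n*m (4 ^ j) 3) ⟩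
      slotStart j r + 3 * 4 ^ j ≡⟨ next-slot m r (4 ^ j) ⟩
      (m + 3 * suc r) * 4 ^ j   ≤⟨ *-monoˡ-≤ (4 ^ j) (+-monoʳ-≤ m (*-monoʳ-≤ 3 r<m)) ⟩
      (m + 3 * m) * 4 ^ j       ≡⟨ level-up m (4 ^ j) ⟩
      m * 4 ^ suc j             ≤⟨ *-monoʳ-≤ m (^-monoʳ-≤ 4 (below-J j level)) ⟩
      m * 4 ^ J                 ∎
      where
      open ≤-Reasoning
      level-up : ∀ m a → (m + 3 * m) * a ≡ m * (4 * a)
      level-up = solve-∀
      below-J : ∀ j → (j ≡ 0 ⊎ (lo ≤ j × j < J)) → suc j ≤ J
      below-J .0 (inj₁ refl)      = ≤-trans (s≤s z≤n) lo≤J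
      below-J j  (inj₂ (_ , j<J)) = j<J

    letterAt : ℕ → List Slot → ℕ → ℕ
    letterAt z []      y = 0
    letterAt z (e ∷ L) y with position z e ≟ y
    ... | yes _ = valueAt z e
    ... | no  _ = letterAt z L y

    letterAt-nonzero : ∀ z L y → 0 < letterAt z L y →
                       ∃ λ e → e ∈ L × position z e ≡ y × letterAt z L y ≡ valueAt z e
    letterAt-nonzero z (e ∷ L) y nonzero with position z e ≟ y
    ... | yes at-y = e , here refl , at-y , refl
    ... | no  _ with letterAt-nonzero z L y nonzero
    ... | e' , e'∈ , at-y , is-value = e' , there e'∈ , at-y , is-value

    letterAt-hit : ∀ z L y e → e ∈ L → position z e ≡ y → (∀ e' → e' ∈ L → position z e' ≡ y → e' ≡ e) →
                   letterAt z L y ≡ valueAt z e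
    letterAt-hit z (e₀ ∷ L) y e e∈ at-y only-e with position z e₀ ≟ y
    ... | yes e₀-at-y = cong (valueAt z) (only-e e₀ (here refl) e₀-at-y)
    ... | no  e₀-not-at-y with e∈
    ... | here refl = ⊥-elim (e₀-not-at-y at-y)
    ... | there e∈L = letterAt-hit z L y e e∈L at-y (λ e' e'∈ → only-e e' (there e'∈))

    letterAt-miss : ∀ z L y → (∀ e → e ∈ L → position z e ≢ y) → letterAt z L y ≡ 0
    letterAt-miss z []      y _    = refl
    letterAt-miss z (e ∷ L) y none with position z e ≟ y
    ... | yes at-y = ⊥-elim (none e (here refl) at-y)
    ... | no  _    = letterAt-miss z L y (λ e' e'∈ → none e' (there e'∈))

    tail : ℕ → ℕ → ℕ
    tail z y = letterAt z slots y

    tail-at-slot : ∀ z e → e ∈ slots → tail z (position z e) ≡ valueAt z e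
    tail-at-slot z e e∈ = letterAt-hit z slots _ e e∈ refl λ e' e'∈ at → position-injective z z e' e e'∈ e∈ at

    tail≤ : ∀ z y → tail z y ≤ suc t
    tail≤ z y with tail z y in eq
    ... | zero  = z≤n
    ... | suc _ with letterAt-nonzero z slots y (subst (0 <_) (sym eq) z<s)
    ... | (j , r) , _ , _ , is-value = subst (_≤ suc t) (trans (sym is-value) eq) (value≤ z j r)

    letter-before : ∀ z j r j' r' → Valid (j , r) → (j , r) <ₛ (j' , r') →
                    suc (position z (j , r)) + 2 * 4 ^ j ≤ position z (j' , r')
    letter-before z j r j' r' v e<e' = begin
      suc (slotStart j r + offset z j r) + 2 * a   ≡⟨ cong (_+ 2 * a) (sym (+-suc (slotStart j r) _)) ⟩
      slotStart j r + suc (offset z j r) + 2 * a   ≤⟨ +-monoˡ-≤ (2 * a) (+-monoʳ-≤ (slotStart j r) (offset<width z j r v)) ⟩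
      slotStart j r + a + 2 * a                    ≡⟨ three-widths (slotStart j r) a ⟩
      slotStart j r + 3 * a                        ≤⟨ gap j r j' r' (proj₂ v) e<e' ⟩
      slotStart j' r'                              ≤⟨ m≤m+n (slotStart j' r') _ ⟩
      position z (j' , r')                         ∎
      where
      open ≤-Reasoning
      a : ℕ
      a = 4 ^ j
      three-widths : ∀ s a → s + a + 2 * a ≡ s + 3 * a
      three-widths = solve-∀

    position≤ : ∀ z j r → Valid (j , r) → position z (j , r) ≤ M * (2 * 4 ^ j)
    position≤ z j r v = begin
      slotStart j r + offset z j r    ≤⟨ +-monoʳ-≤ (slotStart j r) (<⇒≤ (offset<width z j r v)) ⟩
      (m + 3 * r) * a + a             ≡⟨ one-more (m + 3 * r) a ⟩
      (m + 3 * r + 1) * a             ≤⟨ *-monoˡ-≤ a slot-index≤ ⟩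
      2 * M * a                       ≡⟨ twice M a ⟩
      M * (2 * a)                     ∎
      where
      open ≤-Reasoning
      a : ℕ
      a = 4 ^ j
      one-more : ∀ s a → s * a + a ≡ (s + 1) * a
      one-more = solve-∀
      twice : ∀ M a → 2 * M * a ≡ M * (2 * a)
      twice = solve-∀
      next : ∀ m r → m + 3 * r + 1 + 2 ≡ m + 3 * suc r
      next = solve-∀
      four : ∀ m → m + 3 * m ≡ 4 * m
      four = solve-∀
      slot-index≤ : m + 3 * r + 1 ≤ 2 * M
      slot-index≤ = +-cancelʳ-≤ 2 _ _ (begin
        m + 3 * r + 1 + 2 ≡⟨ next m r ⟩
        m + 3 * suc r     ≤⟨ +-monoʳ-≤ m (*-monoʳ-≤ 3 (proj₂ v)) ⟩
        m + 3 * m         ≡⟨ four m ⟩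
        4 * m             ≤⟨ slots≤spread ⟩
        2 * M + 2         ∎)

    spread-slots : ∀ z e₁ e₂ → e₁ ∈ slots → e₂ ∈ slots → position z e₁ < position z e₂ →
                   position z e₁ + M * suc (position z e₁) ≤ M * position z e₂
    spread-slots z (j , r) (j' , r') e₁∈ e₂∈ y₁<y₂ with ×-≡-dec _≟_ _≟_ (j , r) (j' , r')
    ... | yes refl = ⊥-elim (<-irrefl refl y₁<y₂)
    ... | no  e₁≢e₂ with <ₛ-connex (j , r) (j' , r') e₁≢e₂
    ... | inj₂ e₂<e₁ = ⊥-elim (<-asym y₁<y₂ (inside-before j' r' j r _ _ (proj₂ (valid e₂∈)) e₂<e₁ (offset<width z j' r' (valid e₂∈))))
    ... | inj₁ e₁<e₂ = begin
      y₁ + M * suc y₁             ≤⟨ +-monoˡ-≤ (M * suc y₁) (position≤ z j r (valid e₁∈)) ⟩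
      M * (2 * a) + M * suc y₁    ≡⟨ sym (*-distribˡ-+ M (2 * a) (suc y₁)) ⟩
      M * (2 * a + suc y₁)        ≡⟨ cong (M *_) (+-comm (2 * a) (suc y₁)) ⟩
      M * (suc y₁ + 2 * a)        ≤⟨ *-monoʳ-≤ M (letter-before z j r j' r' (valid e₁∈) e₁<e₂) ⟩
      M * position z (j' , r')    ∎
      where
      open ≤-Reasoning
      a  = 4 ^ j
      y₁ : ℕ
      y₁ = position z (j , r)

    tail-spread : ∀ z y₁ y₂ → y₁ < y₂ → 0 < tail z y₁ → 0 < tail z y₂ → y₁ + M * suc y₁ ≤ M * y₂
    tail-spread z y₁ y₂ y₁<y₂ nz₁ nz₂ with letterAt-nonzero z slots y₁ nz₁ | letterAt-nonzero z slots y₂ nz₂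
    ... | e₁ , e₁∈ , refl , _ | e₂ , e₂∈ , refl , _ = spread-slots z e₁ e₂ e₁∈ e₂∈ y₁<y₂

    sparse : ℕ → ℕ → ℕ
    sparse z x with x <? P
    ... | yes _ = suc (suc x)
    ... | no  _ = tail z (x ∸ P)

    sparse-prefix : ∀ z x → x < P → sparse z x ≡ suc (suc x)
    sparse-prefix z x x<P with x <? P
    ... | yes _   = refl
    ... | no  x≮P = ⊥-elim (x≮P x<P)

    sparse-tail : ∀ z y → sparse z (P + y) ≡ tail z y
    sparse-tail z y with (P + y) <? P
    ... | yes P+y<P = ⊥-elim (<-irrefl refl (<-≤-trans P+y<P (m≤m+n P y)))
    ... | no  _     = cong (tail z) (m+n∸m≡n P y)

    sparse-tail′ : ∀ z x → P ≤ x → sparse z x ≡ tail z (x ∸ P)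
    sparse-tail′ z x P≤x = trans (cong (sparse z) (sym (m+[n∸m]≡n P≤x))) (sparse-tail z (x ∸ P))

    sparse<δ : ∀ z x → sparse z x < 2 + P
    sparse<δ z x with x <? P
    ... | yes x<P = s≤s (s≤s x<P)
    ... | no  _   = <-≤-trans (s≤s (tail≤ z (x ∸ P))) values<δ

    P+m<n : P + m < n
    P+m<n = <-≤-trans (+-monoʳ-< P (m<m*n m (4 ^ J) 1<4ᴶ)) fits
      where
      1<4ᴶ : 1 < 4 ^ J
      1<4ᴶ = <-≤-trans (s≤s (s≤s z≤n)) (^-monoʳ-≤ 4 {1} (≤-trans (s≤s z≤n) lo≤J))

    occurs : ∀ z c → c < 2 + P → ∃ λ x → x < n × sparse z x ≡ c
    occurs z zero _ = P + 0 , <-trans (+-monoʳ-< P (s≤s z≤n)) P+m<n ,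
      trans (sparse-tail z 0) (letterAt-miss z slots 0 λ (j , r) _ at-0 →
        <-irrefl (sym at-0) (<-≤-trans z<s (≤-trans (m≤slotStart j r) (m≤m+n _ _))))
    occurs z (suc zero) _ = P + m , P+m<n ,
      trans (cong (λ y → sparse z (P + y)) (sym origin-at-m))
            (trans (sparse-tail z (position z (0 , 0))) (tail-at-slot z (0 , 0) origin∈slots))
      where
      origin-at-m : position z (0 , 0) ≡ m
      origin-at-m = trans (+-identityʳ (slotStart 0 0)) (trans (*-identityʳ (m + 0)) (+-identityʳ m))
    occurs z (suc (suc c)) (s≤s (s≤s c<P)) = c , <-≤-trans c<P (≤-trans (m≤m+n P _) fits) , sparse-prefix z c c<P

    spread : ∀ z x y → P ≤ x → x < y → 0 < sparse z x → 0 < sparse z y → x + M * suc x ≤ P + M * y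
    spread z x y P≤x x<y nzx nzy = begin
      x + M * suc x                       ≡⟨ cong (λ u → u + M * suc u) (sym x≡) ⟩
      (P + y₁) + M * suc (P + y₁)         ≡⟨ shift-left P M y₁ ⟩
      (P + M * P) + (y₁ + M * suc y₁)     ≤⟨ +-monoʳ-≤ (P + M * P) (tail-spread z y₁ y₂ y₁<y₂
                                               (subst (0 <_) (sparse-tail′ z x P≤x) nzx) (subst (0 <_) (sparse-tail′ z y P≤y) nzy)) ⟩
      (P + M * P) + M * y₂                ≡⟨ shift-right P M y₂ ⟩
      P + M * (P + y₂)                    ≡⟨ cong (λ u → P + M * u) y≡ ⟩
      P + M * y                           ∎
      where
      open ≤-Reasoning
      P≤y : P ≤ y
      P≤y = ≤-trans P≤x (<⇒≤ x<y)
      y₁ : ℕ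
      y₁ = x ∸ P
      y₂ : ℕ
      y₂ = y ∸ P
      x≡ : P + y₁ ≡ x
      x≡ = m+[n∸m]≡n P≤x
      y≡ : P + y₂ ≡ y
      y≡ = m+[n∸m]≡n P≤y
      y₁<y₂ : y₁ < y₂
      y₁<y₂ = +-cancelˡ-< P y₁ y₂ (subst₂ _<_ (sym x≡) (sym y≡) x<y)
      shift-left : ∀ P M y → (P + y) + M * suc (P + y) ≡ (P + M * P) + (y + M * suc y)
      shift-left = solve-∀
      shift-right : ∀ P M y → (P + M * P) + M * y ≡ P + M * (P + y)
      shift-right = solve-∀

    hasDelta : (∀ k → 2 ≤ k → suc (P + M * (k ∸ 2)) + (suc t * k + 1) ≤ (2 + P) * k) →
               2 + P ≤ N → ∀ z → HasDelta (word (sparse z) n) (2 + P)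
    hasDelta budget δ≤N z = hasDelta-criterion (sparse z) n (2 + P) P (suc t) M (≤-trans (s≤s z≤n) P+m<n) δ≤N
      (λ x _ → sparse<δ z x) (occurs z)
      (λ x P≤x → subst (_≤ suc t) (sym (sparse-tail′ z x P≤x)) (tail≤ z (x ∸ P)))
      (spread z) budget

    same-slot : ∀ z z' e → e ∈ slots → 0 < tail z' (position z e) →
                position z' e ≡ position z e × tail z' (position z e) ≡ valueAt z' e
    same-slot z z' e e∈ nonzero with letterAt-nonzero z' slots (position z e) nonzero
    ... | e' , e'∈ , at , is-value with position-injective z' z e' e e'∈ e∈ at
    ... | refl = at , is-value

    code-readable : ∀ z z' a r → a < J ∸ lo → r < m →
                    sparse z (P + position z (lo + a , r)) ≡ sparse z' (P + position z (lo + a , r)) →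
                    code z (lo + a) r ≡ code z' (lo + a) r
    code-readable z z' a r a< r<m agree = begin
      code z j r                                             ≡⟨ m≡m%n+[m/n]*n (code z j r) (suc w) ⟩
      code z j r % suc w + (code z j r / suc w) * suc w      ≡⟨ cong₂ (λ o q → o + q * suc w) offsets quotients ⟩
      code z' j r % suc w + (code z' j r / suc w) * suc w    ≡⟨ sym (m≡m%n+[m/n]*n (code z' j r) (suc w)) ⟩
      code z' j r                                            ∎
      where
      open ≡-Reasoning
      j : ℕ
      j = lo + a
      e : Slot
      e = (j , r)
      e∈ : e ∈ slots
      e∈ = coded∈slots a r a< r<m
      y : ℕ
      y = position z e
      letter-z' : tail z' y ≡ value z j r
      letter-z' = trans (sym (sparse-tail z' y)) (trans (sym agree) (trans (sparse-tail z y) (tail-at-slot z e e∈)))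
      slot-in-z' : position z' e ≡ y × tail z' y ≡ valueAt z' e
      slot-in-z' = same-slot z z' e e∈ (subst (0 <_) (sym letter-z') z<s)
      offsets : offset z j r ≡ offset z' j r
      offsets = sym (+-cancelˡ-≡ (slotStart j r) _ _ (proj₁ slot-in-z'))
      quotients : code z j r / suc w ≡ code z' j r / suc w
      quotients = suc-injective (trans (sym letter-z') (proj₂ slot-in-z'))

    -- Every digit of the code belongs to one coded slot, so codes are recoverable.
    injective : ∀ z z' → z < base ^ codeLength → z' < base ^ codeLength →
                (∀ x → x < n → sparse z x ≡ sparse z' x) → z ≡ z'
    injective z z' z< z'< agree = digits-injective base codeLength z z' z< z'< same-digit
      where
      same-digit : ∀ i → i < codeLength → digit base z i ≡ digit base z' i
      same-digit i i<K = subst (λ u → digit base z u ≡ digit base z' u) index≡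
          (code-readable z z' a r a< r<m (agree (P + position z (lo + a , r)) in-word))
        where
        a : ℕ
        a = i / m
        r : ℕ
        r = i % m
        a< : a < J ∸ lo
        a< = m<n*o⇒m/o<n i<K
        r<m : r < m
        r<m = m%n<n i m
        index≡ : digitIndex (lo + a) r ≡ i
        index≡ = trans (cong (λ u → u * m + r) (m+n∸m≡n lo a)) (trans (+-comm (a * m) r) (sym (m≡m%n+[m/n]*n i m)))
        valid-slot : Valid (lo + a , r)
        valid-slot = valid (coded∈slots a r a< r<m)
        in-word : P + position z (lo + a , r) < n
        in-word = <-≤-trans (+-monoʳ-< P (<-≤-trans (+-monoʳ-< (slotStart (lo + a) r) (offset<width z (lo + a) r valid-slot))
                                                   (slot-end≤ (lo + a) r valid-slot))) fits

  sparse-family : (n P m0 M w t lo-1 J : ℕ) →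
    4 * suc m0 ≤ 2 * M + 2 → suc t < 2 + P → suc lo-1 ≤ J → suc w ≤ 4 ^ suc lo-1 →
    P + suc m0 * 4 ^ J ≤ n → 2 + P ≤ N →
    (∀ k → 2 ≤ k → suc (P + M * (k ∸ 2)) + (suc t * k + 1) ≤ (2 + P) * k) →
    Family N n (2 + P) ((suc w * suc t) ^ ((J ∸ suc lo-1) * suc m0))
  sparse-family n P m0 M w t lo-1 J slots≤spread values<δ lo≤J offsets≤width fits δ≤N budget =
    family sparse n (2 + P) (base ^ codeLength) δ≤N (λ z x _ → sparse<δ z x) (λ z _ → hasDelta budget δ≤N z) injective
    where open SparseWords n P m0 M w t lo-1 J slots≤spread values<δ lo≤J offsets≤width fits

module Arithmetic where

  open ≤-Reasoning

  ^-distribʳ-* : ∀ a b o → (a * b) ^ o ≡ a ^ o * b ^ o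
  ^-distribʳ-* a b zero    = refl
  ^-distribʳ-* a b (suc o) = trans (cong ((a * b) *_) (^-distribʳ-* a b o)) (interchange a b (a ^ o) (b ^ o))
    where
    interchange : ∀ a b x y → a * b * (x * y) ≡ a * x * (b * y)
    interchange = solve-∀

  ^-swap : ∀ a b c → (a ^ b) ^ c ≡ (a ^ c) ^ b
  ^-swap a b c = trans (^-*-assoc a b c) (trans (cong (a ^_) (*-comm b c)) (sym (^-*-assoc a c b)))

  n<2^[1+log₂n] : ∀ n → n < 2 ^ suc ⌊log₂ n ⌋
  n<2^[1+log₂n] n with n <? 2 ^ suc ⌊log₂ n ⌋
  ... | yes n< = n<
  ... | no  n≮ = ⊥-elim (<-irrefl refl (≤-trans (≤-reflexive (sym (⌊log₂[2^n]⌋≡n (suc ⌊log₂ n ⌋)))) (⌊log₂⌋-mono-≤ (≮⇒≥ n≮))))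

  2^log₂n≤n : ∀ n → 1 ≤ n → 2 ^ ⌊log₂ n ⌋ ≤ n
  2^log₂n≤n = <-rec (λ n → 1 ≤ n → 2 ^ ⌊log₂ n ⌋ ≤ n) step
    where
    step : ∀ n → (∀ {m} → m < n → 1 ≤ m → 2 ^ ⌊log₂ m ⌋ ≤ m) → 1 ≤ n → 2 ^ ⌊log₂ n ⌋ ≤ n
    step 1                 _  _ = ≤-refl
    step n@(suc (suc n-2)) ih _ = begin
      2 ^ ⌊log₂ n ⌋                 ≡⟨ cong (2 ^_) (sym (m+[n∸m]≡n 1≤log₂n)) ⟩
      2 * 2 ^ (⌊log₂ n ⌋ ∸ 1)       ≡⟨ cong (λ u → 2 * 2 ^ u) (sym (⌊log₂⌊n/2⌋⌋≡⌊log₂n⌋∸1 n)) ⟩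
      2 * 2 ^ ⌊log₂ ⌊ n /2⌋ ⌋       ≤⟨ *-monoʳ-≤ 2 (ih (s≤s (s≤s (⌊n/2⌋≤n n-2))) (s≤s z≤n)) ⟩
      2 * ⌊ n /2⌋                   ≡⟨ cong (⌊ n /2⌋ +_) (+-identityʳ _) ⟩
      ⌊ n /2⌋ + ⌊ n /2⌋             ≤⟨ +-monoʳ-≤ ⌊ n /2⌋ (⌊n/2⌋≤⌈n/2⌉ n) ⟩
      ⌊ n /2⌋ + ⌈ n /2⌉             ≡⟨ ⌊n/2⌋+⌈n/2⌉≡n n ⟩
      n                             ∎
      where
      1≤log₂n : 1 ≤ ⌊log₂ n ⌋
      1≤log₂n = ⌊log₂⌋-mono-≤ {2} {n} (s≤s (s≤s z≤n))

  succ-pow-deficit : ∀ b k → k ≤ b → suc b ^ k * (b ∸ k) ≤ b ^ suc k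
  succ-pow-deficit b zero    _   = ≤-reflexive (trans (*-identityˡ b) (sym (*-identityʳ b)))
  succ-pow-deficit b (suc k) k<b = begin
    suc b ^ suc k * c            ≡⟨ regroup (suc b) (suc b ^ k) c ⟩
    suc b ^ k * (suc b * c)      ≡⟨ cong (suc b ^ k *_) (spread-out b c) ⟩
    suc b ^ k * (c + b * c)      ≤⟨ *-monoʳ-≤ (suc b ^ k) (+-monoˡ-≤ (b * c) (m∸n≤m b (suc k))) ⟩
    suc b ^ k * (b + b * c)      ≡⟨ rearrange (suc b ^ k) b c ⟩
    b * (suc b ^ k * suc c)      ≡⟨ cong (λ u → b * (suc b ^ k * u)) (sym b∸k) ⟩
    b * (suc b ^ k * (b ∸ k))    ≤⟨ *-monoʳ-≤ b (succ-pow-deficit b k (≤-trans (n≤1+n k) k<b)) ⟩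
    b * b ^ suc k                ∎
    where
    c : ℕ
    c = b ∸ suc k
    b∸k : b ∸ k ≡ suc c
    b∸k = +-∸-assoc 1 k<b
    regroup : ∀ s x c → s * x * c ≡ x * (s * c)
    regroup = solve-∀
    spread-out : ∀ b c → suc b * c ≡ c + b * c
    spread-out = solve-∀
    rearrange : ∀ x b c → x * (b + b * c) ≡ b * (x * suc c)
    rearrange = solve-∀

  -- (1 + 1/a)^a ≤ 4.  The deficit bound with b = 2a, k = a gives
  -- (2a+1)^a ≤ 2·(2a)^a, and (2a+2)·2a ≤ (2a+1)², so (2a+2)^a ≤ 4·(2a)^a.
  succ-pow-self≤ : ∀ a → 1 ≤ a → suc a ^ a ≤ 4 * a ^ a
  succ-pow-self≤ a 1≤a = *-cancelˡ-≤ (2 ^ a) {{m^n≢0 2 a}} (begin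
    2 ^ a * suc a ^ a     ≡⟨ sym (^-distribʳ-* 2 (suc a) a) ⟩
    Z                     ≤⟨ Z≤4Y ⟩
    4 * Y                 ≡⟨ cong (4 *_) (^-distribʳ-* 2 a a) ⟩
    4 * (2 ^ a * a ^ a)   ≡⟨ swap4 (2 ^ a) (a ^ a) ⟩
    2 ^ a * (4 * a ^ a)   ∎)
    where
    X Y Z : ℕ
    X = suc (2 * a) ^ a
    Y = (2 * a) ^ a
    Z = (2 * suc a) ^ a
    swap4 : ∀ x y → 4 * (x * y) ≡ x * (4 * y)
    swap4 = solve-∀
    Y>0 : 0 < Y
    Y>0 = m^n>0 (2 * a) {{>-nonZero (≤-trans 1≤a (m≤n*m a 2))}} a
    X≤2Y : X ≤ 2 * Y
    X≤2Y = *-cancelʳ-≤ X (2 * Y) a {{>-nonZero 1≤a}} (begin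
      X * a             ≡⟨ cong (X *_) (sym 2a∸a) ⟩
      X * (2 * a ∸ a)   ≤⟨ succ-pow-deficit (2 * a) a (m≤n*m a 2) ⟩
      2 * a * Y         ≡⟨ shuffle a Y ⟩
      2 * Y * a         ∎)
      where
      2a∸a : 2 * a ∸ a ≡ a
      2a∸a = trans (cong (_∸ a) (cong (a +_) (+-identityʳ a))) (m+n∸n≡m a a)
      shuffle : ∀ a Y → 2 * a * Y ≡ 2 * Y * a
      shuffle = solve-∀
    Z≤4Y : Z ≤ 4 * Y
    Z≤4Y = *-cancelʳ-≤ Z (4 * Y) Y {{>-nonZero Y>0}} (begin
      Z * Y                                  ≡⟨ sym (^-distribʳ-* (2 * suc a) (2 * a) a) ⟩
      (2 * suc a * (2 * a)) ^ a              ≤⟨ ^-monoˡ-≤ a (≤-trans (m≤m+n _ 1) (≤-reflexive (square a))) ⟩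
      (suc (2 * a) * suc (2 * a)) ^ a        ≡⟨ ^-distribʳ-* (suc (2 * a)) (suc (2 * a)) a ⟩
      X * X                                  ≤⟨ *-mono-≤ X≤2Y X≤2Y ⟩
      2 * Y * (2 * Y)                        ≡⟨ four-squares Y ⟩
      4 * Y * Y                              ∎)
      where
      square : ∀ a → 2 * suc a * (2 * a) + 1 ≡ suc (2 * a) * suc (2 * a)
      square = solve-∀
      four-squares : ∀ Y → 2 * Y * (2 * Y) ≡ 4 * Y * Y
      four-squares = solve-∀

  -- (a+1)^δ ≤ 4·a^δ whenever 1 ≤ δ ≤ a: multiply by a^(a-δ) to reduce to δ = a.
  succ-pow≤ : ∀ δ c → 1 ≤ δ + c → suc (δ + c) ^ δ ≤ 4 * (δ + c) ^ δ
  succ-pow≤ δ c 1≤a = *-cancelʳ-≤ _ _ (a ^ c) {{>-nonZero (m^n>0 a {{>-nonZero 1≤a}} c)}} (begin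
    suc a ^ δ * a ^ c         ≤⟨ *-monoʳ-≤ (suc a ^ δ) (^-monoˡ-≤ c (n≤1+n a)) ⟩
    suc a ^ δ * suc a ^ c     ≡⟨ sym (^-distribˡ-+-* (suc a) δ c) ⟩
    suc a ^ a                 ≤⟨ succ-pow-self≤ a 1≤a ⟩
    4 * a ^ a                 ≡⟨ cong (4 *_) (^-distribˡ-+-* a δ c) ⟩
    4 * (a ^ δ * a ^ c)       ≡⟨ sym (*-assoc 4 (a ^ δ) (a ^ c)) ⟩
    4 * a ^ δ * a ^ c         ∎)
    where
    a : ℕ
    a = δ + c

  add-pow≤ : ∀ δ x → 1 ≤ δ → (δ + x) ^ δ ≤ 4 ^ x * δ ^ δ
  add-pow≤ δ zero    _   = ≤-reflexive (trans (cong (_^ δ) (+-identityʳ δ)) (sym (+-identityʳ (δ ^ δ))))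
  add-pow≤ δ (suc x) 1≤δ = begin
    (δ + suc x) ^ δ     ≡⟨ cong (_^ δ) (+-suc δ x) ⟩
    suc (δ + x) ^ δ     ≤⟨ succ-pow≤ δ x (≤-trans 1≤δ (m≤m+n δ x)) ⟩
    4 * (δ + x) ^ δ     ≤⟨ *-monoʳ-≤ 4 (add-pow≤ δ x 1≤δ) ⟩
    4 * (4 ^ x * δ ^ δ) ≡⟨ sym (*-assoc 4 (4 ^ x) (δ ^ δ)) ⟩
    4 ^ suc x * δ ^ δ   ∎

  -- n^(δL) ≤ Y·δ^(δL) as soon as n < 2^(L+1) and 2^l ≤ δ with L = l + D, and
  -- Y ≥ 2^E for an exponent E ≥ (D+1)·δL: the factor 2^(l·δL) is paid by δ^(δL).
  log-bound : ∀ n δ L l D E Y → L ≡ l + D → n < 2 ^ suc L → 2 ^ l ≤ δ →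
              suc D * (δ * (l + D)) ≤ E → 2 ^ E ≤ Y → n ^ (δ * L) ≤ Y * δ ^ (δ * L)
  log-bound n δ .(l + D) l D E Y refl n< 2^l≤δ exponent 2^E≤Y = begin
    n ^ X                           ≤⟨ ^-monoˡ-≤ X (<⇒≤ n<) ⟩
    (2 ^ suc (l + D)) ^ X           ≡⟨ ^-*-assoc 2 (suc (l + D)) X ⟩
    2 ^ (suc (l + D) * X)           ≡⟨ cong (2 ^_) (split l D X) ⟩
    2 ^ (suc D * X + l * X)         ≡⟨ ^-distribˡ-+-* 2 (suc D * X) (l * X) ⟩
    2 ^ (suc D * X) * 2 ^ (l * X)   ≤⟨ *-mono-≤ (^-monoʳ-≤ 2 exponent) (≤-reflexive (sym (^-*-assoc 2 l X))) ⟩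
    2 ^ E * (2 ^ l) ^ X             ≤⟨ *-mono-≤ 2^E≤Y (^-monoˡ-≤ X 2^l≤δ) ⟩
    Y * δ ^ X                       ∎
    where
    X : ℕ
    X = δ * (l + D)
    split : ∀ l D X → suc (l + D) * X ≡ suc D * X + l * X
    split = solve-∀

  succ-quarter : ∀ a → 4 * suc (a / 4) ≤ 4 + a × suc a ≤ 4 * suc (a / 4)
  succ-quarter a = ≤-trans (≤-reflexive (four-more (a / 4))) (+-monoʳ-≤ 4 ≤a) , <a+4
    where
    four-more : ∀ q → 4 * suc q ≡ 4 + 4 * q
    four-more = solve-∀
    ≤a : 4 * (a / 4) ≤ a
    ≤a = subst (_≤ a) (*-comm (a / 4) 4) (m/n*n≤m a 4)
    <a+4 : suc a ≤ 4 * suc (a / 4)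
    <a+4 = begin
      suc a                        ≡⟨ cong suc (m≡m%n+[m/n]*n a 4) ⟩
      suc (a % 4 + a / 4 * 4)      ≤⟨ +-monoˡ-≤ (a / 4 * 4) (m%n<n a 4) ⟩
      4 + a / 4 * 4                ≡⟨ four-more′ (a / 4) ⟩
      4 * suc (a / 4)              ∎
      where
      four-more′ : ∀ q → 4 + q * 4 ≡ 4 * suc q
      four-more′ = solve-∀

  close-exponent : ∀ D l v → D ≤ 8 → 1 ≤ l → 1 ≤ v → suc D * (suc v * (l + D)) ≤ l * v * 1024
  close-exponent D l v D≤8 1≤l 1≤v = begin
    suc D * (suc v * (l + D))   ≤⟨ *-mono-≤ (s≤s D≤8) (*-mono-≤ v+1≤2v (+-monoʳ-≤ l D≤8l)) ⟩
    9 * (2 * v * (9 * l))       ≡⟨ collect l v ⟩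
    l * v * 162                 ≤⟨ *-monoʳ-≤ (l * v) (m≤m+n 162 862) ⟩
    l * v * 1024                ∎
    where
    v+1≤2v : suc v ≤ 2 * v
    v+1≤2v = subst (_≤ 2 * v) (+-comm v 1) (+-monoʳ-≤ v (subst (1 ≤_) (sym (+-identityʳ v)) 1≤v))
    D≤8l : D ≤ 8 * l
    D≤8l = ≤-trans D≤8 (m≤m*n 8 l {{>-nonZero 1≤l}})
    collect : ∀ l v → 9 * (2 * v * (9 * l)) ≡ l * v * 162
    collect = solve-∀

  far-exponent : ∀ d l' δ m h → δ ≤ 8 * m → 3 + d ≤ 4 * h →
                 suc (9 + d) * (δ * (suc l' + (9 + d))) ≤ (2 * h + l') * (h * m) * 1024
  far-exponent d l' δ m h δ≤8m 3+d≤4h = begin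
    suc (9 + d) * (δ * (suc l' + (9 + d)))      ≤⟨ *-mono-≤ D+1≤16h (*-mono-≤ δ≤8m L≤) ⟩
    16 * h * (8 * m * (8 * (2 * h + l')))       ≡⟨ collect h m l' ⟩
    (2 * h + l') * (h * m) * 1024               ∎
    where
    D+1≤16h : suc (9 + d) ≤ 16 * h
    D+1≤16h = begin
      suc (9 + d)                  ≤⟨ m≤m+n _ (2 + 3 * d) ⟩
      suc (9 + d) + (2 + 3 * d)    ≡⟨ quadruple d ⟩
      4 * (3 + d)                  ≤⟨ *-monoʳ-≤ 4 3+d≤4h ⟩
      4 * (4 * h)                  ≡⟨ sym (*-assoc 4 4 h) ⟩
      16 * h                       ∎
      where
      quadruple : ∀ d → suc (9 + d) + (2 + 3 * d) ≡ 4 * (3 + d)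
      quadruple = solve-∀
    L≤ : suc l' + (9 + d) ≤ 8 * (2 * h + l')
    L≤ = begin
      suc l' + (9 + d)                              ≤⟨ m≤m+n _ (2 + 3 * d + 7 * l') ⟩
      suc l' + (9 + d) + (2 + 3 * d + 7 * l')       ≡⟨ regroup d l' ⟩
      4 * (3 + d) + 8 * l'                          ≤⟨ +-monoˡ-≤ (8 * l') (*-monoʳ-≤ 4 3+d≤4h) ⟩
      4 * (4 * h) + 8 * l'                          ≡⟨ eight h l' ⟩
      8 * (2 * h + l')                              ∎
      where
      regroup : ∀ d l' → suc l' + (9 + d) + (2 + 3 * d + 7 * l') ≡ 4 * (3 + d) + 8 * l'
      regroup = solve-∀
      eight : ∀ h l' → 4 * (4 * h) + 8 * l' ≡ 8 * (2 * h + l')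
      eight = solve-∀
    collect : ∀ h m l' → 16 * h * (8 * m * (8 * (2 * h + l'))) ≡ (2 * h + l') * (h * m) * 1024
    collect = solve-∀

  far-budget : ∀ P M T r → 2 * T ≤ 2 + P → 2 * M ≤ 2 + P →
               suc (P + M * r) + (T * (2 + r) + 1) ≤ (2 + P) * (2 + r)
  far-budget P M T r 2T≤δ 2M≤δ = begin
    suc (P + M * r) + (T * (2 + r) + 1)   ≡⟨ expand P M T r ⟩
    (P + 2 + 2 * T) + (M + T) * r         ≤⟨ +-mono-≤ (+-monoʳ-≤ (P + 2) 2T≤δ) (*-monoˡ-≤ r M+T≤δ) ⟩
    (P + 2 + (2 + P)) + (2 + P) * r       ≡⟨ factor P r ⟩
    (2 + P) * (2 + r)                     ∎
    where
    expand : ∀ P M T r → suc (P + M * r) + (T * (2 + r) + 1) ≡ (P + 2 + 2 * T) + (M + T) * r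
    expand = solve-∀
    factor : ∀ P r → (P + 2 + (2 + P)) + (2 + P) * r ≡ (2 + P) * (2 + r)
    factor = solve-∀
    M+T≤δ : M + T ≤ 2 + P
    M+T≤δ = *-cancelˡ-≤ 2 (begin
      2 * (M + T)         ≡⟨ *-distribˡ-+ 2 M T ⟩
      2 * M + 2 * T       ≤⟨ +-mono-≤ 2M≤δ 2T≤δ ⟩
      (2 + P) + (2 + P)   ≡⟨ cong ((2 + P) +_) (sym (+-identityʳ (2 + P))) ⟩
      2 * (2 + P)         ∎)

  far-fits : ∀ l d h P m → 2 + P ≤ 2 ^ suc l → 4 * m ≤ 4 + P → 4 * h ≤ 6 + d →
             P + m * 4 ^ (h + h) ≤ 2 ^ (l + (9 + d))
  far-fits l d h P m δ≤2^[l+1] 4m≤4+P 4h≤6+d = begin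
    P + m * 4 ^ (h + h)               ≤⟨ +-mono-≤ P≤ m4ʰ≤ ⟩
    2 ^ (l + (8 + d)) + 2 ^ (l + (8 + d)) ≡⟨ cong (2 ^ (l + (8 + d)) +_) (sym (+-identityʳ _)) ⟩
    2 ^ suc (l + (8 + d))             ≡⟨ cong (2 ^_) (sym (+-suc l (8 + d))) ⟩
    2 ^ (l + (9 + d))                 ∎
    where
    P≤ : P ≤ 2 ^ (l + (8 + d))
    P≤ = ≤-trans (m≤n+m P 2) (≤-trans δ≤2^[l+1] (^-monoʳ-≤ 2 (subst (_≤ l + (8 + d)) (+-comm l 1) (+-monoʳ-≤ l (s≤s z≤n)))))
    4m≤ : 4 * m ≤ 2 ^ (2 + l)
    4m≤ = begin
      4 * m             ≤⟨ 4m≤4+P ⟩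
      4 + P             ≤⟨ m≤m+n (4 + P) P ⟩
      4 + P + P         ≡⟨ double P ⟩
      2 * (2 + P)       ≤⟨ *-monoʳ-≤ 2 δ≤2^[l+1] ⟩
      2 ^ (2 + l)       ∎
      where
      double : ∀ P → 4 + P + P ≡ 2 * (2 + P)
      double = solve-∀
    m4ʰ≤ : m * 4 ^ (h + h) ≤ 2 ^ (l + (8 + d))
    m4ʰ≤ = begin
      m * 4 ^ (h + h)           ≤⟨ *-monoˡ-≤ (4 ^ (h + h)) (m≤n*m m 4) ⟩
      4 * m * 4 ^ (h + h)       ≤⟨ *-monoˡ-≤ (4 ^ (h + h)) 4m≤ ⟩
      2 ^ (2 + l) * 4 ^ (h + h) ≡⟨ cong (2 ^ (2 + l) *_) (trans (^-*-assoc 2 2 (h + h)) (cong (2 ^_) (quadruple h))) ⟩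
      2 ^ (2 + l) * 2 ^ (4 * h) ≡⟨ sym (^-distribˡ-+-* 2 (2 + l) (4 * h)) ⟩
      2 ^ (2 + l + 4 * h)       ≤⟨ ^-monoʳ-≤ 2 (≤-trans (+-monoʳ-≤ (2 + l) 4h≤6+d) (≤-reflexive (shift l d))) ⟩
      2 ^ (l + (8 + d))         ∎
      where
      quadruple : ∀ h → 2 * (h + h) ≡ 4 * h
      quadruple = solve-∀
      shift : ∀ l d → 2 + l + (6 + d) ≡ l + (8 + d)
      shift = solve-∀

  -- For n = δ + q (q < δ, so L ≤ l + 1): n^(δL) ≤ (δ^q)^1024·δ^(δL), because
  -- (δ + q)^δ ≤ 4^q·δ^δ and 4^L ≤ δ^1024.
  short-bound : ∀ δ q L l → 1 ≤ δ → L ≤ suc l → 1 ≤ l → 2 ^ l ≤ δ →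
                (δ + q) ^ (δ * L) ≤ (δ ^ q) ^ 1024 * δ ^ (δ * L)
  short-bound δ q L l 1≤δ L≤l+1 1≤l 2^l≤δ = begin
    (δ + q) ^ (δ * L)             ≡⟨ sym (^-*-assoc (δ + q) δ L) ⟩
    ((δ + q) ^ δ) ^ L             ≤⟨ ^-monoˡ-≤ L (add-pow≤ δ q 1≤δ) ⟩
    (4 ^ q * δ ^ δ) ^ L           ≡⟨ ^-distribʳ-* (4 ^ q) (δ ^ δ) L ⟩
    (4 ^ q) ^ L * (δ ^ δ) ^ L     ≤⟨ *-mono-≤ 4^qL≤ (≤-reflexive (^-*-assoc δ δ L)) ⟩
    (δ ^ q) ^ 1024 * δ ^ (δ * L)  ∎
    where
    2L≤ : 2 * L ≤ l * 1024
    2L≤ = begin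
      2 * L           ≤⟨ *-monoʳ-≤ 2 L≤l+1 ⟩
      2 * suc l       ≡⟨ *-distribˡ-+ 2 1 l ⟩
      2 + 2 * l       ≤⟨ +-monoˡ-≤ (2 * l) (*-monoʳ-≤ 2 1≤l) ⟩
      2 * l + 2 * l   ≡⟨ four-l l ⟩
      l * 4           ≤⟨ *-monoʳ-≤ l (m≤m+n 4 1020) ⟩
      l * 1024        ∎
      where
      four-l : ∀ l → 2 * l + 2 * l ≡ l * 4
      four-l = solve-∀
    4ᴸ≤ : 4 ^ L ≤ δ ^ 1024
    4ᴸ≤ = begin
      4 ^ L           ≡⟨ ^-*-assoc 2 2 L ⟩
      2 ^ (2 * L)     ≤⟨ ^-monoʳ-≤ 2 2L≤ ⟩
      2 ^ (l * 1024)  ≡⟨ sym (^-*-assoc 2 l 1024) ⟩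
      (2 ^ l) ^ 1024  ≤⟨ ^-monoˡ-≤ 1024 2^l≤δ ⟩
      δ ^ 1024        ∎
    4^qL≤ : (4 ^ q) ^ L ≤ (δ ^ q) ^ 1024
    4^qL≤ = begin
      (4 ^ q) ^ L     ≡⟨ ^-swap 4 q L ⟩
      (4 ^ L) ^ q     ≤⟨ ^-monoˡ-≤ q 4ᴸ≤ ⟩
      (δ ^ 1024) ^ q  ≡⟨ ^-swap δ 1024 q ⟩
      (δ ^ q) ^ 1024  ∎

open Arithmetic

Witness : ℕ → ℕ → Set
Witness n δ = Σ (List (Str (n ^ 1))) λ F →
  Unique F × All (λ S → length S ≡ n × HasDelta S δ) F × n ^ (δ * ⌊log₂ n ⌋) ≤ length F ^ 1024 * δ ^ (δ * ⌊log₂ n ⌋)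

module Setting (n δ : ℕ) (2≤δ : 2 ≤ δ) (δ≤n : δ ≤ n) where

  N : ℕ
  N = n ^ 1

  δ≤N : δ ≤ N
  δ≤N = subst (δ ≤_) (sym (*-identityʳ n)) δ≤n

  N>0 : 0 < N
  N>0 = <-≤-trans (s≤s z≤n) (≤-trans 2≤δ δ≤N)

  L l : ℕ
  L = ⌊log₂ n ⌋
  l = ⌊log₂ δ ⌋

  n<2^[1+L] : n < 2 ^ suc L
  n<2^[1+L] = n<2^[1+log₂n] n

  2^L≤n : 2 ^ L ≤ n
  2^L≤n = 2^log₂n≤n n (≤-trans (s≤s z≤n) (≤-trans 2≤δ δ≤n))

  2^l≤δ : 2 ^ l ≤ δ
  2^l≤δ = 2^log₂n≤n δ (≤-trans (s≤s z≤n) 2≤δ)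

  δ<2^[1+l] : δ < 2 ^ suc l
  δ<2^[1+l] = n<2^[1+log₂n] δ

  1≤l : 1 ≤ l
  1≤l = subst (_≤ l) (⌊log₂[2^n]⌋≡n 1) (⌊log₂⌋-mono-≤ 2≤δ)

  l≤L : l ≤ L
  l≤L = ⌊log₂⌋-mono-≤ δ≤n

  witness : ∀ {Z} → Family N n δ Z → n ^ (δ * L) ≤ Z ^ 1024 * δ ^ (δ * L) → Witness n δ
  witness (F , unique , members , refl) bound = F , unique , members , bound

short-case : ∀ n δ → 2 ≤ δ → δ ≤ n → n < 2 * δ → Witness n δ
short-case n zero () _ _
short-case n δ@(suc v) 2≤δ δ≤n n<2δ =
  witness (dense-family n v q q≤v (≤-reflexive δ+q≡n) δ≤N)
    (subst (λ u → u ^ (δ * L) ≤ (δ ^ q) ^ 1024 * δ ^ (δ * L)) δ+q≡n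
      (short-bound δ q L l (s≤s z≤n) L≤l+1 1≤l 2^l≤δ))
  where
  open Setting n δ 2≤δ δ≤n
  open Dense N N>0
  q : ℕ
  q = n ∸ δ
  δ+q≡n : δ + q ≡ n
  δ+q≡n = m+[n∸m]≡n δ≤n
  q≤v : q ≤ v
  q≤v = s≤s⁻¹ (+-cancelˡ-< δ q δ (subst (_< δ + δ) (sym δ+q≡n) (subst (n <_) (cong (δ +_) (+-identityʳ δ)) n<2δ)))
  L≤l+1 : L ≤ suc l
  L≤l+1 with L ≤? suc l
  ... | yes L≤ = L≤
  ... | no  L≰ = ⊥-elim (<-irrefl refl (begin-strict
    n                       <⟨ n<2δ ⟩
    2 * δ                   <⟨ *-monoʳ-< 2 δ<2^[1+l] ⟩
    2 ^ suc (suc l)         ≤⟨ ^-monoʳ-≤ 2 (≰⇒> L≰) ⟩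
    2 ^ L                   ≤⟨ 2^L≤n ⟩
    n                       ∎))
    where open ≤-Reasoning

close-case : ∀ n δ → 2 ≤ δ → 2 * δ ≤ n → ⌊log₂ n ⌋ ≤ ⌊log₂ δ ⌋ + 8 → Witness n δ
close-case n zero () _ _
close-case n δ@(suc v) 2≤δ 2δ≤n close =
  witness (dense-family n v v ≤-refl 2v<n δ≤N)
    (log-bound n δ L l D (l * v * 1024) ((δ ^ v) ^ 1024) L≡l+D n<2^[1+L] 2^l≤δ
      (close-exponent D l v D≤8 1≤l (s≤s⁻¹ 2≤δ)) code-size)
  where
  open Setting n δ 2≤δ (≤-trans (m≤m+n δ (δ + 0)) 2δ≤n)
  open Dense N N>0
  2v<n : suc (v + v) ≤ n
  2v<n = ≤-trans (+-monoʳ-≤ δ (≤-trans (n≤1+n v) (≤-reflexive (sym (+-identityʳ δ))))) 2δ≤n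
  D : ℕ
  D = L ∸ l
  L≡l+D : L ≡ l + D
  L≡l+D = sym (m+[n∸m]≡n l≤L)
  D≤8 : D ≤ 8
  D≤8 = subst (D ≤_) (m+n∸m≡n l 8) (∸-monoˡ-≤ l close)
  code-size : 2 ^ (l * v * 1024) ≤ (δ ^ v) ^ 1024
  code-size = begin
    2 ^ (l * v * 1024)    ≡⟨ sym (^-*-assoc 2 (l * v) 1024) ⟩
    (2 ^ (l * v)) ^ 1024  ≡⟨ cong (_^ 1024) (sym (^-*-assoc 2 l v)) ⟩
    ((2 ^ l) ^ v) ^ 1024  ≤⟨ ^-monoˡ-≤ 1024 (^-monoˡ-≤ v 2^l≤δ) ⟩
    (δ ^ v) ^ 1024        ∎
    where open ≤-Reasoning

balanced-sparse-family : ∀ N → 0 < N → ∀ n P m0 h-1 l' →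
  4 * suc m0 ≤ 4 + P → 2 ^ suc l' ≤ 2 + P → P + suc m0 * 4 ^ (suc h-1 + suc h-1) ≤ n → 2 + P ≤ N →
  Family N n (2 + P) (2 ^ ((2 * suc h-1 + l') * (suc h-1 * suc m0)))
balanced-sparse-family N N>0 n P m0 h-1 l' 4m≤4+P 2T≤δ fits δ≤N =
  subst (Family N n (2 + P)) size
    (sparse-family n P m0 M w t h-1 (h + h) (≤-reflexive (slots≡spread m0)) T<δ (m≤m+n h h) (≤-reflexive W≡) fits δ≤N budget)
  where
  open Sparse N N>0
  h : ℕ
  h = suc h-1
  M : ℕ
  M = 2 * m0 + 1
  t : ℕ
  t = pred (2 ^ l')
  w : ℕ
  w = pred (4 ^ h)
  T≡ : suc t ≡ 2 ^ l'
  T≡ = suc-pred (2 ^ l') {{m^n≢0 2 l'}}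
  W≡ : suc w ≡ 4 ^ h
  W≡ = suc-pred (4 ^ h) {{m^n≢0 4 h}}
  slots≡spread : ∀ m0 → 4 * suc m0 ≡ 2 * (2 * m0 + 1) + 2
  slots≡spread = solve-∀
  T<δ : suc t < 2 + P
  T<δ = <-≤-trans (subst (_< 2 ^ suc l') (sym T≡) (^-monoʳ-< 2 (s≤s (s≤s z≤n)) (n<1+n l'))) 2T≤δ
  2M≤δ : 2 * M ≤ 2 + P
  2M≤δ = +-cancelʳ-≤ 2 _ _ (subst (_≤ 2 + P + 2) (slots≡spread m0) (≤-trans 4m≤4+P (≤-reflexive (+-comm 2 (2 + P)))))
  budget : ∀ k → 2 ≤ k → suc (P + M * (k ∸ 2)) + (suc t * k + 1) ≤ (2 + P) * k
  budget k 2≤k = subst (λ k → suc (P + M * (k ∸ 2)) + (suc t * k + 1) ≤ (2 + P) * k) (m+[n∸m]≡n 2≤k)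
    (far-budget P M (suc t) (k ∸ 2) (subst (λ u → 2 * u ≤ 2 + P) (sym T≡) 2T≤δ) 2M≤δ)
  size : (suc w * suc t) ^ ((h + h ∸ h) * suc m0) ≡ 2 ^ ((2 * h + l') * (h * suc m0))
  size = begin
    (suc w * suc t) ^ ((h + h ∸ h) * suc m0)   ≡⟨ cong₂ (λ b e → b ^ (e * suc m0)) (cong₂ _*_ W≡ T≡) (m+n∸m≡n h h) ⟩
    (4 ^ h * 2 ^ l') ^ (h * suc m0)            ≡⟨ cong (λ b → (b * 2 ^ l') ^ (h * suc m0)) (^-*-assoc 2 2 h) ⟩
    (2 ^ (2 * h) * 2 ^ l') ^ (h * suc m0)      ≡⟨ cong (_^ (h * suc m0)) (sym (^-distribˡ-+-* 2 (2 * h) l')) ⟩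
    (2 ^ (2 * h + l')) ^ (h * suc m0)          ≡⟨ ^-*-assoc 2 (2 * h + l') (h * suc m0) ⟩
    2 ^ ((2 * h + l') * (h * suc m0))          ∎
    where open ≡-Reasoning

-- Regime L ≥ l + 9: the balanced sparse family with m ≈ δ/4 and 4h ≈ L - l.
far-case : ∀ n δ → 2 ≤ δ → δ ≤ n → ⌊log₂ δ ⌋ + 9 ≤ ⌊log₂ n ⌋ → Witness n δ
far-case n 1 (s≤s ()) _ _
far-case n δ@(suc (suc P)) 2≤δ δ≤n far =
  witness (balanced-sparse-family N N>0 n P m0 h-1 l' 4m≤4+P 2^[1+l']≤δ fits δ≤N)
    (log-bound n δ L (suc l') (9 + extra) (code * 1024) ((2 ^ code) ^ 1024) L≡ n<2^[1+L] 2^[1+l']≤δ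
      (far-exponent extra l' δ m h δ≤8m (proj₂ (succ-quarter (2 + extra)))) (≤-reflexive (sym (^-*-assoc 2 code 1024))))
  where
  open Setting n δ 2≤δ δ≤n
  m0 : ℕ
  m0 = P / 4
  m : ℕ
  m = suc m0
  extra : ℕ
  extra = L ∸ (l + 9)
  h-1 : ℕ
  h-1 = (2 + extra) / 4
  h : ℕ
  h = suc h-1
  l' : ℕ
  l' = l ∸ 1
  code : ℕ
  code = (2 * h + l') * (h * m)
  l≡ : suc l' ≡ l
  l≡ = m+[n∸m]≡n 1≤l
  L≡ : L ≡ suc l' + (9 + extra)
  L≡ = trans (sym (m+[n∸m]≡n far)) (trans (+-assoc l 9 extra) (cong (_+ (9 + extra)) (sym l≡)))
  2^[1+l']≤δ : 2 ^ suc l' ≤ δ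
  2^[1+l']≤δ = subst (λ u → 2 ^ u ≤ δ) (sym l≡) 2^l≤δ
  4m≤4+P : 4 * m ≤ 4 + P
  4m≤4+P = proj₁ (succ-quarter P)
  δ≤8m : δ ≤ 8 * m
  δ≤8m = ≤-trans (s≤s (proj₂ (succ-quarter P))) (≤-trans (+-monoˡ-≤ (4 * m) (s≤s z≤n)) (≤-reflexive (double m)))
    where
    double : ∀ m → 4 * m + 4 * m ≡ 8 * m
    double = solve-∀
  fits : P + m * 4 ^ (h + h) ≤ n
  fits = ≤-trans (far-fits (suc l') extra h P m δ≤2^[2+l'] 4m≤4+P (proj₁ (succ-quarter (2 + extra))))
                 (subst (λ u → 2 ^ u ≤ n) L≡ 2^L≤n)
    where
    δ≤2^[2+l'] : 2 + P ≤ 2 ^ suc (suc l')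
    δ≤2^[2+l'] = subst (λ u → 2 + P ≤ 2 ^ suc u) (sym l≡) (<⇒≤ δ<2^[1+l])

theorem2 : Σ ℕ (λ q → 1 ≤ q × Σ ℕ (λ e → (n δ : ℕ) → 2 ≤ δ → δ ≤ n →
             Σ (List (Str (n ^ e))) (λ F →
               Unique F
               × All (λ S → length S ≡ n × HasDelta S δ) F
               × n ^ (δ * ⌊log₂ n ⌋) ≤ length F ^ q * δ ^ (δ * ⌊log₂ n ⌋))))
theorem2 = 1024 , s≤s z≤n , 1 , regimes
  where
  regimes : ∀ n δ → 2 ≤ δ → δ ≤ n → Witness n δ
  regimes n δ 2≤δ δ≤n with n <? 2 * δ | ⌊log₂ n ⌋ ≤? ⌊log₂ δ ⌋ + 8
  ... | yes n<2δ | _         = short-case n δ 2≤δ δ≤n n<2δ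
  ... | no  n≮2δ | yes close = close-case n δ 2≤δ (≮⇒≥ n≮2δ) close
  ... | no  _    | no  far   = far-case n δ 2≤δ δ≤n (subst (_≤ ⌊log₂ n ⌋) (sym (+-suc ⌊log₂ δ ⌋ 8)) (≰⇒> far))
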